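{- Let $G$ be any finite simple graph and $G_c$ its extended double cover. Then \[\frac{\mathrm{box}(G)}{2}\le \mathrm{box}(G_c)\le \mathrm{box}(G)+2.\]
   Context: The extended double cover $G_c$ of $G$ is the bipartite graph with partite sets $A$ and $B$, which are copies of $V(G)$: for each $u\in V(G)$ there are vertices $u_A\in A$ and $u_B\in B$, and $\{u_A,v_B\}$ is an edge of $G_c$ iff $u=v$ or $u$ is adjacent to $v$ in $G$ (there are no edges inside $A$ or inside $B$). The boxicity $\mathrm{box}(H)$ of a graph $H$ is the minimum $k$ such that vertices can be mapped to products of $k$ closed real intervals with two vertices adjacent iff their boxes intersect; complete graphs have boxicity $0$.
   Formalization: The closed intervals whose products form the boxes, for both G and G_c, have rational endpoints rather than real ones. -}

module Defs where

open import Level using (0ℓ)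
open import Data.Nat using (ℕ; _<_)
open import Data.Fin using (Fin)
open import Data.Rational using (ℚ; _≤_)
open import Data.Product using (_×_)
open import Data.Sum using (_⊎_; inj₁; inj₂)
open import Data.Empty using (⊥)
open import Relation.Nullary using (¬_)
open import Relation.Binary.PropositionalEquality using (_≡_)
open import Function.Bundles using (_⇔_)

record SimpleGraph (V : Set) : Set₁ where
  field
    Adj    : V → V → Set
    sym    : ∀ {u v} → Adj u v → Adj v u
    irrefl : ∀ {u} → ¬ Adj u u
open SimpleGraph public

-- Extended double cover: partite sets A = inj₁ copies, B = inj₂ copies.
-- u_A ~ v_B iff u ≡ v or u ~ v in G; no edges inside A or inside B.
DCAdj : ∀ {V} → SimpleGraph V → V ⊎ V → V ⊎ V → Set
DCAdj G (inj₁ u) (inj₂ v) = u ≡ v ⊎ Adj G u v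
DCAdj G (inj₂ u) (inj₁ v) = v ≡ u ⊎ Adj G v u
DCAdj G (inj₁ _) (inj₁ _) = ⊥
DCAdj G (inj₂ _) (inj₂ _) = ⊥

DCsym : ∀ {V} (G : SimpleGraph V) {x y : V ⊎ V} → DCAdj G x y → DCAdj G y x
DCsym G {inj₁ u} {inj₂ v} p = p
DCsym G {inj₂ u} {inj₁ v} p = p

DCirrefl : ∀ {V} (G : SimpleGraph V) {x : V ⊎ V} → ¬ DCAdj G x x
DCirrefl G {inj₁ u} ()
DCirrefl G {inj₂ u} ()

extendedDoubleCover : ∀ {V} → SimpleGraph V → SimpleGraph (V ⊎ V)
extendedDoubleCover G = record
  { Adj = DCAdj G ; sym = DCsym G ; irrefl = DCirrefl G }

IntervalsMeet : ℚ → ℚ → ℚ → ℚ → Set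
IntervalsMeet a b c d = (a ≤ d) × (c ≤ b)

record BoxRep {V : Set} (G : SimpleGraph V) (k : ℕ) : Set where
  field
    lo hi   : V → Fin k → ℚ
    nonempty : ∀ v i → lo v i ≤ hi v i
    represents : ∀ u v → ¬ u ≡ v →
      (Adj G u v ⇔ (∀ i → IntervalsMeet (lo u i) (hi u i) (lo v i) (hi v i)))

-- box(G) = k : k is the least dimension admitting a box representation.
-- (For k = 0 every vertex gets the empty product, so complete graphs have
-- boxicity 0.)
IsBoxicity : ∀ {V} → SimpleGraph V → ℕ → Set
IsBoxicity G k = BoxRep G k × (∀ m → m < k → ¬ BoxRep G m)

{-# OPTIONS --safe #-}
-- Upper bound: keep a box representation of G for both copies of every vertex and add two
-- axes; u_A is the point u on the first and spans everything on the second, u_B the other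
-- way round.  Then copies on the same side are separated, while u_A meets v_B exactly when
-- the boxes of u and v meet, i.e. when u = v or u ~ v.
-- Lower bound: from boxes of G_c in dimension k, give u in coordinate (0, j) the interval
-- [lo u_A, hi u_B] and in (1, j) the interval [lo u_B, hi u_A].  These 2k intervals of u
-- and v meet exactly when both boxes u_A, v_B and v_A, u_B meet, i.e. when u ~ v.
module Submission where

open import Defs
open import Data.Nat using (ℕ; _≤_; _+_; _*_)
open import Data.Fin using (Fin)
open import Data.Product using (_×_)
open import Data.Sum using (_⊎_)

open import Data.Nat using (z≤n)
open import Data.Nat.Properties using (≮⇒≥)
open import Data.Integer using (+_; +≤+; ∣_∣) renaming (_≤_ to _≤ℤ_)
open import Data.Integer.Properties using (*-identityʳ)
open import Data.Fin using (zero; suc; toℕ; _≟_)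
open import Data.Fin.Properties using (toℕ-injective; toℕ≤n; +↔⊎; *↔×)
open import Data.Rational using (ℚ; ↥_; *≤*) renaming (_≤_ to _≤ℚ_)
open import Data.Rational.Literals using (fromℤ)
open import Data.Rational.Properties using (≤-refl; ≤-antisym)
open import Data.Product using (_,_; proj₁; proj₂; swap)
open import Data.Sum using (inj₁; inj₂; reduce)
open import Data.Empty using (⊥-elim)
open import Relation.Nullary using (¬_; yes; no)
open import Relation.Binary.PropositionalEquality using (_≡_; refl; cong; subst; subst₂)
import Relation.Binary.PropositionalEquality as ≡
open import Function.Bundles using (_⇔_; mk⇔; _↔_; Inverse; Equivalence)

boxicity-≤ : ∀ {V} {G : SimpleGraph V} {k m : ℕ} → IsBoxicity G k → BoxRep G m → k ≤ m
boxicity-≤ (_ , minimal) R = ≮⇒≥ (λ m<k → minimal _ m<k R)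

ℕ→ℚ : ℕ → ℚ
ℕ→ℚ k = fromℤ (+ k)

ℕ→ℚ-mono-≤ : ∀ {a b} → a ≤ b → ℕ→ℚ a ≤ℚ ℕ→ℚ b
ℕ→ℚ-mono-≤ {a} {b} a≤b =
  *≤* (subst₂ _≤ℤ_ (≡.sym (*-identityʳ (+ a))) (≡.sym (*-identityʳ (+ b))) (+≤+ a≤b))

ℕ→ℚ-injective : ∀ {a b} → ℕ→ℚ a ≡ ℕ→ℚ b → a ≡ b
ℕ→ℚ-injective = cong (λ q → ∣ ↥ q ∣)

meet-sym : ∀ {a b c d} → IntervalsMeet a b c d → IntervalsMeet c d a b
meet-sym = swap

meet-refl : ∀ {a b} → a ≤ℚ b → IntervalsMeet a b a b
meet-refl a≤b = a≤b , a≤b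

points-meet⇒≡ : ∀ {a b} → IntervalsMeet a a b b → a ≡ b
points-meet⇒≡ (a≤b , b≤a) = ≤-antisym a≤b b≤a

record BoxRepOn {V : Set} (G : SimpleGraph V) (I : Set) : Set where
  field
    lo hi      : V → I → ℚ
    nonempty   : ∀ v i → lo v i ≤ℚ hi v i
    represents : ∀ u v → ¬ u ≡ v →
      (Adj G u v ⇔ (∀ i → IntervalsMeet (lo u i) (hi u i) (lo v i) (hi v i)))

BoxRepOn⇒BoxRep : ∀ {V I k} {G : SimpleGraph V} → Fin k ↔ I → BoxRepOn G I → BoxRep G k
BoxRepOn⇒BoxRep {G = G} k↔I R = record
  { lo         = λ v i → lo v (to i)
  ; hi         = λ v i → hi v (to i)
  ; nonempty   = λ v i → nonempty v (to i)
  ; represents = λ u v u≢v →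
      let open Equivalence (represents u v u≢v) renaming (to to meet; from to adj) in
      mk⇔ (λ a i → meet a (to i)) (λ m → adj (λ i → subst (Meet u v) (strictlyInverseˡ i) (m (from i))))
  }
  where
  open BoxRepOn R
  open Inverse k↔I using (to; from; strictlyInverseˡ)
  Meet : _ → _ → _ → Set
  Meet u v i = IntervalsMeet (lo u i) (hi u i) (lo v i) (hi v i)

module ExtendedDoubleCoverUpper {n b : ℕ} {G : SimpleGraph (Fin n)} (R : BoxRep G b) where
  open BoxRep R

  ⟦_⟧ : Fin n → ℚ
  ⟦ u ⟧ = ℕ→ℚ (toℕ u)

  lo⁺ hi⁺ : Fin n ⊎ Fin n → Fin b ⊎ Fin 2 → ℚ
  lo⁺ x        (inj₁ j)          = lo (reduce x) j
  lo⁺ (inj₁ u) (inj₂ zero)       = ⟦ u ⟧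
  lo⁺ (inj₂ u) (inj₂ zero)       = ℕ→ℚ 0
  lo⁺ (inj₁ u) (inj₂ (suc zero)) = ℕ→ℚ 0
  lo⁺ (inj₂ u) (inj₂ (suc zero)) = ⟦ u ⟧
  hi⁺ x        (inj₁ j)          = hi (reduce x) j
  hi⁺ (inj₁ u) (inj₂ zero)       = ⟦ u ⟧
  hi⁺ (inj₂ u) (inj₂ zero)       = ℕ→ℚ n
  hi⁺ (inj₁ u) (inj₂ (suc zero)) = ℕ→ℚ n
  hi⁺ (inj₂ u) (inj₂ (suc zero)) = ⟦ u ⟧

  Meet⁺ : Fin n ⊎ Fin n → Fin n ⊎ Fin n → Set
  Meet⁺ x y = ∀ i → IntervalsMeet (lo⁺ x i) (hi⁺ x i) (lo⁺ y i) (hi⁺ y i)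

  nonempty⁺ : ∀ x i → lo⁺ x i ≤ℚ hi⁺ x i
  nonempty⁺ x        (inj₁ j)          = nonempty (reduce x) j
  nonempty⁺ (inj₁ u) (inj₂ zero)       = ≤-refl
  nonempty⁺ (inj₂ u) (inj₂ zero)       = ℕ→ℚ-mono-≤ z≤n
  nonempty⁺ (inj₁ u) (inj₂ (suc zero)) = ℕ→ℚ-mono-≤ z≤n
  nonempty⁺ (inj₂ u) (inj₂ (suc zero)) = ≤-refl

  closedAdj⇒meet : ∀ u v → u ≡ v ⊎ Adj G u v → Meet⁺ (inj₁ u) (inj₂ v)
  closedAdj⇒meet u .u (inj₁ refl) (inj₁ j) = meet-refl (nonempty u j)
  closedAdj⇒meet u v  (inj₂ u~v)  (inj₁ j) =
    Equivalence.to (represents u v (λ { refl → irrefl G u~v })) u~v j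
  closedAdj⇒meet u v  _ (inj₂ zero)       = ℕ→ℚ-mono-≤ (toℕ≤n u) , ℕ→ℚ-mono-≤ z≤n
  closedAdj⇒meet u v  _ (inj₂ (suc zero)) = ℕ→ℚ-mono-≤ z≤n , ℕ→ℚ-mono-≤ (toℕ≤n v)

  meet⇒closedAdj : ∀ u v → Meet⁺ (inj₁ u) (inj₂ v) → u ≡ v ⊎ Adj G u v
  meet⇒closedAdj u v m with u ≟ v
  ... | yes u≡v = inj₁ u≡v
  ... | no  u≢v = inj₂ (Equivalence.from (represents u v u≢v) (λ j → m (inj₁ j)))

  boxRepOn : BoxRepOn (extendedDoubleCover G) (Fin b ⊎ Fin 2)
  boxRepOn = record { lo = lo⁺ ; hi = hi⁺ ; nonempty = nonempty⁺ ; represents = represents⁺ }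
    where
    represents⁺ : ∀ x y → ¬ x ≡ y → DCAdj G x y ⇔ Meet⁺ x y
    represents⁺ (inj₁ u) (inj₁ v) x≢y = mk⇔ (λ ())
      (λ m → x≢y (cong inj₁ (toℕ-injective (ℕ→ℚ-injective (points-meet⇒≡ (m (inj₂ zero)))))))
    represents⁺ (inj₂ u) (inj₂ v) x≢y = mk⇔ (λ ())
      (λ m → x≢y (cong inj₂ (toℕ-injective (ℕ→ℚ-injective (points-meet⇒≡ (m (inj₂ (suc zero))))))))
    represents⁺ (inj₁ u) (inj₂ v) _ = mk⇔ (closedAdj⇒meet u v) (meet⇒closedAdj u v)
    represents⁺ (inj₂ u) (inj₁ v) _ =
      mk⇔ (λ a i → meet-sym (closedAdj⇒meet v u a i)) (λ m → meet⇒closedAdj v u (λ i → meet-sym (m i)))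

extendedDoubleCover-boxRep : ∀ {n b} {G : SimpleGraph (Fin n)} →
  BoxRep G b → BoxRep (extendedDoubleCover G) (b + 2)
extendedDoubleCover-boxRep R = BoxRepOn⇒BoxRep +↔⊎ (ExtendedDoubleCoverUpper.boxRepOn R)

module ExtendedDoubleCoverLower {V : Set} {k : ℕ} {G : SimpleGraph V}
                                (R : BoxRep (extendedDoubleCover G) k) where
  open BoxRep R

  BoxesMeet : V ⊎ V → V ⊎ V → Set
  BoxesMeet x y = ∀ j → IntervalsMeet (lo x j) (hi x j) (lo y j) (hi y j)

  lo⁻ hi⁻ : V → Fin 2 × Fin k → ℚ
  lo⁻ u (zero     , j) = lo (inj₁ u) j
  lo⁻ u (suc zero , j) = lo (inj₂ u) j
  hi⁻ u (zero     , j) = hi (inj₂ u) j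
  hi⁻ u (suc zero , j) = hi (inj₁ u) j

  Meet⁻ : V → V → Set
  Meet⁻ u v = ∀ i → IntervalsMeet (lo⁻ u i) (hi⁻ u i) (lo⁻ v i) (hi⁻ v i)

  crossMeet⇒meet : ∀ {u v} → BoxesMeet (inj₁ u) (inj₂ v) → BoxesMeet (inj₁ v) (inj₂ u) → Meet⁻ u v
  crossMeet⇒meet uv vu (zero     , j) = proj₁ (uv j) , proj₁ (vu j)
  crossMeet⇒meet uv vu (suc zero , j) = proj₂ (vu j) , proj₂ (uv j)

  meet⇒crossMeet : ∀ {u v} → Meet⁻ u v → BoxesMeet (inj₁ u) (inj₂ v)
  meet⇒crossMeet m j = proj₁ (m (zero , j)) , proj₂ (m (suc zero , j))

  closedAdj⇔boxesMeet : ∀ u v → (u ≡ v ⊎ Adj G u v) ⇔ BoxesMeet (inj₁ u) (inj₂ v)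
  closedAdj⇔boxesMeet u v = represents (inj₁ u) (inj₂ v) (λ ())

  nonempty⁻ : ∀ u i → lo⁻ u i ≤ℚ hi⁻ u i
  nonempty⁻ u (zero     , j) = proj₁ (Equivalence.to (closedAdj⇔boxesMeet u u) (inj₁ refl) j)
  nonempty⁻ u (suc zero , j) = proj₂ (Equivalence.to (closedAdj⇔boxesMeet u u) (inj₁ refl) j)

  represents⁻ : ∀ u v → ¬ u ≡ v → Adj G u v ⇔ Meet⁻ u v
  represents⁻ u v u≢v = mk⇔ adj⇒meet meet⇒adj
    where
    adj⇒meet : Adj G u v → Meet⁻ u v
    adj⇒meet u~v = crossMeet⇒meet (Equivalence.to (closedAdj⇔boxesMeet u v) (inj₂ u~v))
                                  (Equivalence.to (closedAdj⇔boxesMeet v u) (inj₂ (sym G u~v)))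
    meet⇒adj : Meet⁻ u v → Adj G u v
    meet⇒adj m with Equivalence.from (closedAdj⇔boxesMeet u v) (meet⇒crossMeet m)
    ... | inj₁ u≡v = ⊥-elim (u≢v u≡v)
    ... | inj₂ u~v = u~v

  boxRepOn : BoxRepOn G (Fin 2 × Fin k)
  boxRepOn = record { lo = lo⁻ ; hi = hi⁻ ; nonempty = nonempty⁻ ; represents = represents⁻ }

boxRep-fromExtendedDoubleCover : ∀ {V k} {G : SimpleGraph V} →
  BoxRep (extendedDoubleCover G) k → BoxRep G (2 * k)
boxRep-fromExtendedDoubleCover R = BoxRepOn⇒BoxRep *↔× (ExtendedDoubleCoverLower.boxRepOn R)

lemma2 : (n : ℕ) (G : SimpleGraph (Fin n)) (b bc : ℕ) →
    IsBoxicity G b → IsBoxicity (extendedDoubleCover G) bc →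
    (b ≤ 2 * bc) × (bc ≤ b + 2)
lemma2 n G b bc boxG boxGc =
  boxicity-≤ boxG (boxRep-fromExtendedDoubleCover (proj₁ boxGc)) ,
  boxicity-≤ boxGc (extendedDoubleCover-boxRep (proj₁ boxG))
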